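{- Let $\mathbb{F}$ be a field and let $\mathcal{C}$ be a linear code over $\mathbb{F}$ such that every basis $B$ of $\mathcal{C}$ contains a vector $b$ having two entries $f,p$ that do not belong to a common cyclic subgroup of the additive group of $\mathbb{F}$. Then $\mathcal{C}$ is not triangular representable.
   Context: A linear code of length $n$ over $\mathbb{F}$ is a linear subspace $\mathcal{C}\subseteq\mathbb{F}^n$. Partial order: $c\preceq d$ if $c^i\neq0$ implies $d^i\neq0$ for all $i$; $d$ is minimal if $c\preceq d$ implies $c=d$. For $S\subseteq\{1,\dots,n\}$, $\mathcal{C}/S$ is obtained by deleting the entries indexed by $S$ from every codeword. A triangular configuration is a 2-dimensional simplicial complex whose maximal simplices are triangles or edges; its incidence matrix has rows indexed by edges, columns by triangles, entry $1$ if the edge belongs to the triangle and $0$ otherwise; $\ker\Delta$ is the kernel of this matrix over $\mathbb{F}$. $\mathcal{C}$ is triangular representable if there exist a triangular configuration $\Delta$ and a set $S$ of coordinates with $\mathcal{C}=\ker\Delta/S$, and a linear bijection between $\mathcal{C}$ and $\ker\Delta$ mapping minimal codewords to minimal codewords. -}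

module Defs where

open import Level using (Level; _⊔_; suc)
open import Algebra.Bundles using (CommutativeRing)
open import Data.Nat as ℕ using (ℕ)
open import Data.Integer as ℤ using (ℤ; +_; -[1+_])
open import Data.Fin as Fin using (Fin)
open import Data.Fin.Properties using (_≟_)
open import Data.Product using (Σ; ∃; ∃-syntax; _×_; _,_; proj₁; proj₂)
open import Data.Sum using (_⊎_)
open import Data.Bool using (Bool; _∧_; _∨_; if_then_else_)
open import Relation.Nullary using (¬_; does)
open import Relation.Binary.PropositionalEquality using (_≡_)

record Field (c ℓ : Level) : Set (suc (c ⊔ ℓ)) where
  field
    commutativeRing : CommutativeRing c ℓ
  open CommutativeRing commutativeRing public
  field
    0≉1     : ¬ (0# ≈ 1#)
    inverse : ∀ x → ¬ (x ≈ 0#) → ∃[ y ] (x * y ≈ 1#)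

module _ {c ℓ : Level} (𝔽 : Field c ℓ) where
  open Field 𝔽

  Vec𝔽 : ℕ → Set c
  Vec𝔽 n = Fin n → Carrier

  _≋_ : ∀ {n} → Vec𝔽 n → Vec𝔽 n → Set ℓ
  x ≋ y = ∀ i → x i ≈ y i

  zeroV : ∀ {n} → Vec𝔽 n
  zeroV _ = 0#

  _⊕_ : ∀ {n} → Vec𝔽 n → Vec𝔽 n → Vec𝔽 n
  (x ⊕ y) i = x i + y i

  _⊙_ : ∀ {n} → Carrier → Vec𝔽 n → Vec𝔽 n
  (a ⊙ x) i = a * x i

  Σ𝔽 : ∀ {k} → (Fin k → Carrier) → Carrier
  Σ𝔽 {ℕ.zero} f = 0#
  Σ𝔽 {ℕ.suc k} f = f Fin.zero + Σ𝔽 (λ i → f (Fin.suc i))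

  lincomb : ∀ {k n} → (Fin k → Carrier) → (Fin k → Vec𝔽 n) → Vec𝔽 n
  lincomb a b j = Σ𝔽 (λ i → a i * b i j)

  record LinearCode (n : ℕ) : Set (suc (c ⊔ ℓ)) where
    field
      _∈C      : Vec𝔽 n → Set (c ⊔ ℓ)
      resp     : ∀ {x y} → x ≋ y → x ∈C → y ∈C
      zero∈    : zeroV ∈C
      +-closed : ∀ {x y} → x ∈C → y ∈C → (x ⊕ y) ∈C
      ·-closed : ∀ a {x} → x ∈C → (a ⊙ x) ∈C
  open LinearCode public

  record IsBasis {n : ℕ} (C : LinearCode n) {k : ℕ} (b : Fin k → Vec𝔽 n)
         : Set (c ⊔ ℓ) where
    field
      members     : ∀ i → _∈C C (b i)
      independent : ∀ (a : Fin k → Carrier) → lincomb a b ≋ zeroV → ∀ i → a i ≈ 0#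
      spanning    : ∀ x → _∈C C x → ∃[ a ] (x ≋ lincomb a b)

  _×ℕ_ : ℕ → Carrier → Carrier
  ℕ.zero ×ℕ g = 0#
  ℕ.suc m ×ℕ g = g + (m ×ℕ g)

  _·ℤ_ : ℤ → Carrier → Carrier
  (+ m) ·ℤ g = m ×ℕ g
  -[1+ m ] ·ℤ g = - (ℕ.suc m ×ℕ g)

  CommonCyclic : Carrier → Carrier → Set (c ⊔ ℓ)
  CommonCyclic f p = ∃[ g ] ∃[ m₁ ] ∃[ m₂ ] ((f ≈ m₁ ·ℤ g) × (p ≈ m₂ ·ℤ g))

  _⪯_ : ∀ {n} → Vec𝔽 n → Vec𝔽 n → Set ℓ
  x ⪯ y = ∀ i → ¬ (x i ≈ 0#) → ¬ (y i ≈ 0#)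

  NonZeroV : ∀ {n} → Vec𝔽 n → Set ℓ
  NonZeroV x = ¬ (x ≋ zeroV)

  -- minimal codeword: a nonzero codeword x such that every nonzero
  -- codeword d with d ⪯ x has the same support as x (d ⪯ x ⇒ x ⪯ d).
  -- (stated for an arbitrary code predicate, so it applies both to a
  -- LinearCode and to ker Δ)
  Minimal : ∀ {n} {p} → (Vec𝔽 n → Set p) → Vec𝔽 n → Set (c ⊔ ℓ ⊔ p)
  Minimal C x = C x × NonZeroV x
              × (∀ d → C d → NonZeroV d → d ⪯ x → x ⪯ d)

-- The edge list
-- contains ALL edges of the complex (maximal ones and faces of triangles).

record TriangularConfiguration : Set where
  field
    V E T     : ℕ
    edge      : Fin E → Fin V × Fin V
    edge-ord  : ∀ e → proj₁ (edge e) Fin.< proj₂ (edge e)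
    edge-inj  : ∀ e e′ → edge e ≡ edge e′ → e ≡ e′
    tri       : Fin T → Fin V × Fin V × Fin V
    tri-ord   : ∀ t → (proj₁ (tri t) Fin.< proj₁ (proj₂ (tri t)))
                    × (proj₁ (proj₂ (tri t)) Fin.< proj₂ (proj₂ (tri t)))
    tri-inj   : ∀ t t′ → tri t ≡ tri t′ → t ≡ t′
    face₁     : ∀ t → ∃[ e ] (edge e ≡ (proj₁ (tri t) , proj₁ (proj₂ (tri t))))
    face₂     : ∀ t → ∃[ e ] (edge e ≡ (proj₁ (tri t) , proj₂ (proj₂ (tri t))))
    face₃     : ∀ t → ∃[ e ] (edge e ≡ (proj₁ (proj₂ (tri t)) , proj₂ (proj₂ (tri t))))
    -- maximal simplices are edges or triangles: no isolated vertices
    no-isolated : ∀ v → ∃[ e ] ((proj₁ (edge e) ≡ v) ⊎ (proj₂ (edge e) ≡ v))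
    -- 2-dimensional: there is at least one triangle
    two-dim   : 1 ℕ.≤ T

module _ {c ℓ : Level} (𝔽 : Field c ℓ) where
  open Field 𝔽
  open TriangularConfiguration

  _∈▵_ : ∀ {V} → Fin V → Fin V × Fin V × Fin V → Bool
  v ∈▵ (a , b , d) = does (v ≟ a) ∨ does (v ≟ b) ∨ does (v ≟ d)

  incidence : (Δ : TriangularConfiguration) → Fin (E Δ) → Fin (T Δ) → Carrier
  incidence Δ e t = if (proj₁ (edge Δ e) ∈▵ tri Δ t) ∧ (proj₂ (edge Δ e) ∈▵ tri Δ t)
                    then 1# else 0#

  InKer : (Δ : TriangularConfiguration) → Vec𝔽 𝔽 (T Δ) → Set ℓ
  InKer Δ x = ∀ e → Σ𝔽 𝔽 (λ t → incidence Δ e t * x t) ≈ 0#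

  -- deleting the coordinates in S ⊆ Fin T: encoded by the strictly
  -- increasing enumeration ι : Fin n → Fin T of the complement of S;
  -- the punctured word is z ∘ ι.
  StrictlyIncreasing : ∀ {n m} → (Fin n → Fin m) → Set
  StrictlyIncreasing ι = ∀ i j → i Fin.< j → ι i Fin.< ι j

  record MinimalPreservingLinearBijection {n : ℕ} (C : LinearCode 𝔽 n)
           (Δ : TriangularConfiguration) (φ : Vec𝔽 𝔽 n → Vec𝔽 𝔽 (T Δ))
           : Set (c ⊔ ℓ) where
    field
      resp      : ∀ x y → _∈C C x → _∈C C y → _≋_ 𝔽 x y → _≋_ 𝔽 (φ x) (φ y)
      into      : ∀ x → _∈C C x → InKer Δ (φ x)
      additive  : ∀ x y → _∈C C x → _∈C C y
                  → _≋_ 𝔽 (φ (_⊕_ 𝔽 x y)) (_⊕_ 𝔽 (φ x) (φ y))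
      homog     : ∀ a x → _∈C C x → _≋_ 𝔽 (φ (_⊙_ 𝔽 a x)) (_⊙_ 𝔽 a (φ x))
      injective : ∀ x y → _∈C C x → _∈C C y → _≋_ 𝔽 (φ x) (φ y) → _≋_ 𝔽 x y
      surjective : ∀ z → InKer Δ z → ∃[ x ] (_∈C C x × _≋_ 𝔽 (φ x) z)
      minimal   : ∀ x → Minimal 𝔽 (_∈C C) x → Minimal 𝔽 (InKer Δ) (φ x)

  TriangularRepresentable : ∀ {n} → LinearCode 𝔽 n → Set (c ⊔ ℓ)
  TriangularRepresentable {n} C =
    ∃[ Δ ] ∃[ ι ] (StrictlyIncreasing {n} {T Δ} ι
      × (∀ x → (_∈C C x → ∃[ z ] (InKer Δ z × _≋_ 𝔽 x (λ i → z (ι i))))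
             × (∀ z → InKer Δ z → _∈C C (λ i → z (ι i))))
      × ∃[ φ ] MinimalPreservingLinearBijection C Δ φ)

module Submission where

-- The incidence matrix of Δ has entries 0 and 1, so ker Δ is spanned by vectors whose entries are
-- integer multiples of 1: imposing the equations one at a time, a spanning family g of the current
-- solution space is replaced by the vectors s j · g i − s i · g j (where s i is the value of the next
-- equation on g i and s j ≠ 0), and this elimination never divides. Puncturing keeps such a spanning
-- family, and eliminating coordinate by coordinate turns it into a basis of C with integral entries.
-- Any two entries of that basis lie in the cyclic subgroup generated by 1, against the hypothesis. Whether a field element
-- is zero is not decidable, so the constructions live in the double-negation monad; this suffices
-- because the goal is a negation.

import Defs
open Defs using (Field; LinearCode; _∈C; resp; zero∈; +-closed; ·-closed; IsBasis; Vec𝔽; CommonCyclic;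
                 incidence; TriangularRepresentable)
open import Level using (Level; _⊔_)
open import Algebra.Solver.Ring.AlmostCommutativeRing
  using (fromCommutativeRing; _-Raw-AlmostCommutative⟶_)
import Algebra.Properties.CommutativeSemigroup as CommutativeSemigroupProperties
import Algebra.Properties.Ring as RingProperties
import Algebra.Properties.Semiring.Mult as SemiringMultiplication
open import Data.Bool using (true; false; if_then_else_)
open import Data.Fin using (Fin; zero; suc)
open import Data.Integer as ℤ using (ℤ; +_; -[1+_])
import Data.Integer.Properties as ℤ
open import Data.Maybe as Maybe using (Maybe)
open import Data.Nat as ℕ using (ℕ)
import Data.Nat.Properties as ℕ
open import Data.Product using (∃-syntax; _×_; _,_; proj₁; proj₂)
import Data.Sign as Sign
open import Data.Sum using (_⊎_; inj₁; inj₂)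
open import Data.Unit.Polymorphic using (⊤)
open import Data.Vec.Functional using (_∷_; tail)
open import Function using (_∘_)
open import Relation.Binary.Consequences using (dec⇒weaklyDec)
open import Relation.Binary.PropositionalEquality as ≡ using (_≡_)
open import Relation.Nullary using (¬_; yes; no)
open import Relation.Nullary.Decidable using (¬¬-excluded-middle)

module IntegerMultiples {c ℓ : Level} (𝔽 : Field c ℓ) where
  open Field 𝔽
  open RingProperties ring
  open SemiringMultiplication semiring using (×-homo-+; ×1-homo-*) renaming (_×_ to _×′_)
  open import Relation.Binary.Reasoning.Setoid setoid

  ι : ℕ → Carrier
  ι n = Defs._×ℕ_ 𝔽 n 1#

  ⟦_⟧ : ℤ → Carrier
  ⟦ z ⟧ = Defs._·ℤ_ 𝔽 z 1#

  ×ℕ≡× : ∀ n x → Defs._×ℕ_ 𝔽 n x ≡ n ×′ x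
  ×ℕ≡× ℕ.zero    x = ≡.refl
  ×ℕ≡× (ℕ.suc n) x = ≡.cong (_+_ x) (×ℕ≡× n x)

  ι-homo-+ : ∀ m n → ι (m ℕ.+ n) ≈ ι m + ι n
  ι-homo-+ m n rewrite ×ℕ≡× (m ℕ.+ n) 1# | ×ℕ≡× m 1# | ×ℕ≡× n 1# = ×-homo-+ 1# m n

  ι-homo-* : ∀ m n → ι (m ℕ.* n) ≈ ι m * ι n
  ι-homo-* m n rewrite ×ℕ≡× (m ℕ.* n) 1# | ×ℕ≡× m 1# | ×ℕ≡× n 1# = ×1-homo-* m n

  ⊖-homo : ∀ m n → ⟦ m ℤ.⊖ n ⟧ ≈ ι m - ι n
  ⊖-homo ℕ.zero    ℕ.zero    = sym (-‿inverseʳ 0#)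
  ⊖-homo (ℕ.suc m) ℕ.zero    = sym (trans (+-congˡ -0#≈0#) (+-identityʳ _))
  ⊖-homo ℕ.zero    (ℕ.suc n) = sym (+-identityˡ _)
  ⊖-homo (ℕ.suc m) (ℕ.suc n) = begin
    ⟦ ℕ.suc m ℤ.⊖ ℕ.suc n ⟧  ≡⟨ ≡.cong ⟦_⟧ (ℤ.[1+m]⊖[1+n]≡m⊖n m n) ⟩
    ⟦ m ℤ.⊖ n ⟧              ≈⟨ ⊖-homo m n ⟩
    ι m - ι n                ≈⟨ +-congʳ (xyx⁻¹≈y 1# (ι m)) ⟨
    1# + ι m - 1# - ι n      ≈⟨ +-assoc _ _ _ ⟩
    1# + ι m + (- 1# - ι n)  ≈⟨ +-congˡ (-‿+-comm 1# (ι n)) ⟩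
    1# + ι m - (1# + ι n)    ∎

  ⟦⟧-homo-+ : ∀ x y → ⟦ x ℤ.+ y ⟧ ≈ ⟦ x ⟧ + ⟦ y ⟧
  ⟦⟧-homo-+ -[1+ m ] -[1+ n ] = begin
    - ι (ℕ.suc (ℕ.suc (m ℕ.+ n)))  ≡⟨ ≡.cong (λ k → - ι (ℕ.suc k)) (ℕ.+-suc m n) ⟨
    - ι (ℕ.suc m ℕ.+ ℕ.suc n)      ≈⟨ -‿cong (ι-homo-+ (ℕ.suc m) (ℕ.suc n)) ⟩
    - (ι (ℕ.suc m) + ι (ℕ.suc n))  ≈⟨ -‿+-comm _ _ ⟨
    - ι (ℕ.suc m) - ι (ℕ.suc n)    ∎
  ⟦⟧-homo-+ -[1+ m ] (+ n)    = trans (⊖-homo n (ℕ.suc m)) (+-comm _ _)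
  ⟦⟧-homo-+ (+ m)    -[1+ n ] = ⊖-homo m (ℕ.suc n)
  ⟦⟧-homo-+ (+ m)    (+ n)    = ι-homo-+ m n

  ⟦⟧-homo-neg : ∀ x → ⟦ ℤ.- x ⟧ ≈ - ⟦ x ⟧
  ⟦⟧-homo-neg -[1+ n ]      = sym (-‿involutive _)
  ⟦⟧-homo-neg (+ ℕ.zero)    = sym -0#≈0#
  ⟦⟧-homo-neg (+ ℕ.suc n)   = refl

  ⟦+◃⟧ : ∀ n → ⟦ Sign.+ ℤ.◃ n ⟧ ≈ ι n
  ⟦+◃⟧ ℕ.zero    = refl
  ⟦+◃⟧ (ℕ.suc n) = refl

  ⟦-◃⟧ : ∀ n → ⟦ Sign.- ℤ.◃ n ⟧ ≈ - ι n
  ⟦-◃⟧ ℕ.zero    = sym -0#≈0#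
  ⟦-◃⟧ (ℕ.suc n) = refl

  ⟦⟧-homo-* : ∀ x y → ⟦ x ℤ.* y ⟧ ≈ ⟦ x ⟧ * ⟦ y ⟧
  ⟦⟧-homo-* -[1+ m ] -[1+ n ] = begin
    ⟦ Sign.+ ℤ.◃ ℕ.suc m ℕ.* ℕ.suc n ⟧  ≈⟨ ⟦+◃⟧ (ℕ.suc m ℕ.* ℕ.suc n) ⟩
    ι (ℕ.suc m ℕ.* ℕ.suc n)            ≈⟨ ι-homo-* (ℕ.suc m) (ℕ.suc n) ⟩
    ι (ℕ.suc m) * ι (ℕ.suc n)          ≈⟨ -‿involutive _ ⟨
    - - (ι (ℕ.suc m) * ι (ℕ.suc n))    ≈⟨ -‿cong (-‿distribʳ-* _ _) ⟩
    - (ι (ℕ.suc m) * - ι (ℕ.suc n))    ≈⟨ -‿distribˡ-* _ _ ⟩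
    - ι (ℕ.suc m) * - ι (ℕ.suc n)      ∎
  ⟦⟧-homo-* -[1+ m ] (+ n) = begin
    ⟦ Sign.- ℤ.◃ ℕ.suc m ℕ.* n ⟧  ≈⟨ ⟦-◃⟧ (ℕ.suc m ℕ.* n) ⟩
    - ι (ℕ.suc m ℕ.* n)          ≈⟨ -‿cong (ι-homo-* (ℕ.suc m) n) ⟩
    - (ι (ℕ.suc m) * ι n)        ≈⟨ -‿distribˡ-* _ _ ⟩
    - ι (ℕ.suc m) * ι n          ∎
  ⟦⟧-homo-* (+ ℕ.zero) -[1+ n ] = sym (zeroˡ _)
  ⟦⟧-homo-* (+ ℕ.suc m) -[1+ n ] = begin
    ⟦ Sign.- ℤ.◃ ℕ.suc m ℕ.* ℕ.suc n ⟧  ≈⟨ ⟦-◃⟧ (ℕ.suc m ℕ.* ℕ.suc n) ⟩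
    - ι (ℕ.suc m ℕ.* ℕ.suc n)          ≈⟨ -‿cong (ι-homo-* (ℕ.suc m) (ℕ.suc n)) ⟩
    - (ι (ℕ.suc m) * ι (ℕ.suc n))      ≈⟨ -‿distribʳ-* _ _ ⟩
    ι (ℕ.suc m) * - ι (ℕ.suc n)        ∎
  ⟦⟧-homo-* (+ m) (+ n) = trans (⟦+◃⟧ (m ℕ.* n)) (ι-homo-* m n)

  ⟦⟧-morphism : ℤ.+-*-rawRing -Raw-AlmostCommutative⟶ fromCommutativeRing commutativeRing
  ⟦⟧-morphism = record
    { ⟦_⟧    = ⟦_⟧
    ; +-homo = ⟦⟧-homo-+
    ; *-homo = ⟦⟧-homo-*
    ; -‿homo = ⟦⟧-homo-neg
    ; 0-homo = refl
    ; 1-homo = +-identityʳ 1#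
    }

  ⟦⟧-weaklyDecidable : ∀ x y → Maybe (⟦ x ⟧ ≈ ⟦ y ⟧)
  ⟦⟧-weaklyDecidable x y = Maybe.map (λ { ≡.refl → refl }) (dec⇒weaklyDec ℤ._≟_ x y)

  open import Algebra.Solver.Ring ℤ.+-*-rawRing (fromCommutativeRing commutativeRing)
    ⟦⟧-morphism ⟦⟧-weaklyDecidable public
    using (solve; _:=_; _:+_; _:*_; :-_)

  Integral : Carrier → Set ℓ
  Integral x = ∃[ z ] (x ≈ ⟦ z ⟧)

  integral-0 : Integral 0#
  integral-0 = + 0 , refl

  integral-1 : Integral 1#
  integral-1 = + 1 , sym (+-identityʳ 1#)

  integral-+ : ∀ {x y} → Integral x → Integral y → Integral (x + y)
  integral-+ (m , x≈m) (n , y≈n) = m ℤ.+ n , trans (+-cong x≈m y≈n) (sym (⟦⟧-homo-+ m n))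

  integral-* : ∀ {x y} → Integral x → Integral y → Integral (x * y)
  integral-* (m , x≈m) (n , y≈n) = m ℤ.* n , trans (*-cong x≈m y≈n) (sym (⟦⟧-homo-* m n))

  integral-neg : ∀ {x} → Integral x → Integral (- x)
  integral-neg (m , x≈m) = ℤ.- m , trans (-‿cong x≈m) (sym (⟦⟧-homo-neg m))

  integral⇒commonCyclic : ∀ {x y} → Integral x → Integral y → CommonCyclic 𝔽 x y
  integral⇒commonCyclic (m , x≈m) (n , y≈n) = 1# , m , n , x≈m , y≈n

module IntegralLinearAlgebra {c ℓ : Level} (𝔽 : Field c ℓ) where
  open Field 𝔽 hiding (zero)
  open IntegerMultiples 𝔽
  open RingProperties ring using (-‿distribˡ-*)
  open CommutativeSemigroupProperties +-commutativeSemigroup using (interchange)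
  open CommutativeSemigroupProperties *-commutativeSemigroup using (x∙yz≈y∙xz)
  open import Relation.Binary.Reasoning.Setoid setoid

  private
    _>>=_ : ∀ {a b} {A : Set a} {B : Set b} → ¬ ¬ A → (A → ¬ ¬ B) → ¬ ¬ B
    (¬¬a >>= f) ¬b = ¬¬a λ a → f a ¬b

    return : ∀ {a} {A : Set a} → A → ¬ ¬ A
    return a ¬a = ¬a a

  Vec : ℕ → Set c
  Vec = Vec𝔽 𝔽

  infix 4 _≋_ _∈_
  infixl 6 _⊕_
  infixr 7 _⊙_

  _≋_ : ∀ {n} → Vec n → Vec n → Set ℓ
  _≋_ = Defs._≋_ 𝔽

  _⊕_ : ∀ {n} → Vec n → Vec n → Vec n
  _⊕_ = Defs._⊕_ 𝔽

  _⊙_ : ∀ {n} → Carrier → Vec n → Vec n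
  _⊙_ = Defs._⊙_ 𝔽

  Σ𝔽 : ∀ {k} → (Fin k → Carrier) → Carrier
  Σ𝔽 = Defs.Σ𝔽 𝔽

  lincomb : ∀ {k n} → (Fin k → Carrier) → (Fin k → Vec n) → Vec n
  lincomb = Defs.lincomb 𝔽

  _∈_ : ∀ {n} → Vec n → LinearCode 𝔽 n → Set (c ⊔ ℓ)
  x ∈ C = _∈C C x

  IntegralVec : ∀ {n} → Vec n → Set ℓ
  IntegralVec v = ∀ i → Integral (v i)

  ∷-integral : ∀ {n a} {v : Vec n} → Integral a → IntegralVec v → IntegralVec (a ∷ v)
  ∷-integral a-integral v-integral zero    = a-integral
  ∷-integral a-integral v-integral (suc i) = v-integral i

  ¬¬-allZero⊎nonzero : ∀ {k} (f : Fin k → Carrier) → ¬ ¬ ((∀ i → f i ≈ 0#) ⊎ ∃[ j ] ¬ (f j ≈ 0#))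
  ¬¬-allZero⊎nonzero {ℕ.zero} f = return (inj₁ λ ())
  ¬¬-allZero⊎nonzero {ℕ.suc k} f = do
    yes f₀≈0 ← ¬¬-excluded-middle
      where no f₀≉0 → return (inj₂ (zero , f₀≉0))
    inj₁ rest≈0 ← ¬¬-allZero⊎nonzero (f ∘ suc)
      where inj₂ (j , fⱼ≉0) → return (inj₂ (suc j , fⱼ≉0))
    return (inj₁ λ { zero → f₀≈0 ; (suc i) → rest≈0 i })

  invertible⇒*-cancelʳ : ∀ {x y β} → y * β ≈ 1# → x * y ≈ 0# → x ≈ 0#
  invertible⇒*-cancelʳ {x} {y} {β} yβ≈1 xy≈0 = begin
    x             ≈⟨ *-identityʳ x ⟨
    x * 1#        ≈⟨ *-congˡ yβ≈1 ⟨
    x * (y * β)   ≈⟨ *-assoc x y β ⟨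
    (x * y) * β   ≈⟨ *-congʳ xy≈0 ⟩
    0# * β        ≈⟨ zeroˡ β ⟩
    0#            ∎

  Σ-cong : ∀ {k} {f g : Fin k → Carrier} → (∀ i → f i ≈ g i) → Σ𝔽 f ≈ Σ𝔽 g
  Σ-cong {ℕ.zero}  f≈g = refl
  Σ-cong {ℕ.suc k} f≈g = +-cong (f≈g zero) (Σ-cong (f≈g ∘ suc))

  Σ-zero : ∀ {k} {f : Fin k → Carrier} → (∀ i → f i ≈ 0#) → Σ𝔽 f ≈ 0#
  Σ-zero {ℕ.zero}  f≈0 = refl
  Σ-zero {ℕ.suc k} f≈0 = trans (+-cong (f≈0 zero) (Σ-zero (f≈0 ∘ suc))) (+-identityˡ 0#)

  Σ-+ : ∀ {k} (f g : Fin k → Carrier) → Σ𝔽 (λ i → f i + g i) ≈ Σ𝔽 f + Σ𝔽 g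
  Σ-+ {ℕ.zero}  f g = sym (+-identityˡ 0#)
  Σ-+ {ℕ.suc k} f g = trans (+-congˡ (Σ-+ (f ∘ suc) (g ∘ suc))) (interchange _ _ _ _)

  Σ-*ˡ : ∀ {k} a (f : Fin k → Carrier) → Σ𝔽 (λ i → a * f i) ≈ a * Σ𝔽 f
  Σ-*ˡ {ℕ.zero}  a f = sym (zeroʳ a)
  Σ-*ˡ {ℕ.suc k} a f = trans (+-congˡ (Σ-*ˡ a (f ∘ suc))) (sym (distribˡ a _ _))

  Σ-linear : ∀ {k} a b (f g : Fin k → Carrier) →
             Σ𝔽 (λ i → a * f i + b * g i) ≈ a * Σ𝔽 f + b * Σ𝔽 g
  Σ-linear a b f g = trans (Σ-+ (λ i → a * f i) (λ i → b * g i)) (+-cong (Σ-*ˡ a f) (Σ-*ˡ b g))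

  Σ-swap : ∀ {k l} (f : Fin k → Fin l → Carrier) →
           Σ𝔽 (λ i → Σ𝔽 (f i)) ≈ Σ𝔽 (λ j → Σ𝔽 (λ i → f i j))
  Σ-swap {ℕ.zero} {l} f = sym (Σ-zero {l} λ _ → refl)
  Σ-swap {ℕ.suc k} f = trans (+-congˡ (Σ-swap (f ∘ suc))) (sym (Σ-+ (f zero) _))

  Σ-integral : ∀ {k} {f : Fin k → Carrier} → (∀ i → Integral (f i)) → Integral (Σ𝔽 f)
  Σ-integral {ℕ.zero}  f-integral = integral-0
  Σ-integral {ℕ.suc k} f-integral = integral-+ (f-integral zero) (Σ-integral (f-integral ∘ suc))

  infix 8 _·_

  _·_ : ∀ {n} → Vec n → Vec n → Carrier
  r · x = Σ𝔽 (λ t → r t * x t)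

  ·-congˡ : ∀ {n} (r : Vec n) {x y} → x ≋ y → r · x ≈ r · y
  ·-congˡ r x≋y = Σ-cong (λ t → *-congˡ (x≋y t))

  ·-additive : ∀ {n} (r : Vec n) x y → r · (x ⊕ y) ≈ r · x + r · y
  ·-additive r x y =
    trans (Σ-cong λ t → distribˡ (r t) (x t) (y t)) (Σ-+ (λ t → r t * x t) (λ t → r t * y t))

  ·-homogeneous : ∀ {n} (r : Vec n) a x → r · (a ⊙ x) ≈ a * (r · x)
  ·-homogeneous r a x = trans (Σ-cong λ t → x∙yz≈y∙xz (r t) a (x t)) (Σ-*ˡ a (λ t → r t * x t))

  ·-zeroʳ : ∀ {n} (r : Vec n) → r · Defs.zeroV 𝔽 ≈ 0#
  ·-zeroʳ r = Σ-zero λ t → zeroʳ (r t)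

  ·-lincomb : ∀ {k n} (r : Vec n) (a : Fin k → Carrier) (g : Fin k → Vec n) →
              r · lincomb a g ≈ Σ𝔽 (λ i → a i * (r · g i))
  ·-lincomb r a g = begin
    Σ𝔽 (λ t → r t * Σ𝔽 (λ i → a i * g i t))
      ≈⟨ Σ-cong (λ t → Σ-*ˡ (r t) (λ i → a i * g i t)) ⟨
    Σ𝔽 (λ t → Σ𝔽 (λ i → r t * (a i * g i t)))
      ≈⟨ Σ-swap (λ t i → r t * (a i * g i t)) ⟩
    Σ𝔽 (λ i → Σ𝔽 (λ t → r t * (a i * g i t)))
      ≈⟨ Σ-cong (λ i → Σ-cong λ t → x∙yz≈y∙xz (r t) (a i) (g i t)) ⟩
    Σ𝔽 (λ i → Σ𝔽 (λ t → a i * (r t * g i t)))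
      ≈⟨ Σ-cong (λ i → Σ-*ˡ (a i) (λ t → r t * g i t)) ⟩
    Σ𝔽 (λ i → a i * (r · g i))
      ∎

  ·-integral : ∀ {n} {r x : Vec n} → IntegralVec r → IntegralVec x → Integral (r · x)
  ·-integral r-integral x-integral = Σ-integral λ t → integral-* (r-integral t) (x-integral t)

  unit : ∀ {n} → Fin n → Vec n
  unit zero    zero    = 1#
  unit zero    (suc _) = 0#
  unit (suc _) zero    = 0#
  unit (suc i) (suc j) = unit i j

  unit-integral : ∀ {n} (i : Fin n) → IntegralVec (unit i)
  unit-integral zero    zero    = integral-1
  unit-integral zero    (suc _) = integral-0
  unit-integral (suc _) zero    = integral-0
  unit-integral (suc i) (suc j) = unit-integral i j

  lincomb-unit : ∀ {n} (x : Vec n) → lincomb x unit ≋ x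
  lincomb-unit x zero    = trans (+-cong (*-identityʳ _) (Σ-zero λ i → zeroʳ (x (suc i)))) (+-identityʳ _)
  lincomb-unit x (suc j) = trans (+-cong (zeroʳ _) (lincomb-unit (tail x) j)) (+-identityˡ _)

  unit₀·x≈x₀ : ∀ {n} (x : Vec (ℕ.suc n)) → unit zero · x ≈ x zero
  unit₀·x≈x₀ x = trans (+-cong (*-identityˡ _) (Σ-zero λ t → zeroˡ (x (suc t)))) (+-identityʳ _)

  wholeSpace : ∀ {n} → LinearCode 𝔽 n
  wholeSpace = record
    { _∈C      = λ _ → ⊤
    ; resp     = λ _ _ → _
    ; zero∈    = _
    ; +-closed = λ _ _ → _
    ; ·-closed = λ _ _ → _
    }

  infixl 5 _∩⊥_

  _∩⊥_ : ∀ {n} → LinearCode 𝔽 n → Vec n → LinearCode 𝔽 n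
  C ∩⊥ r = record
    { _∈C      = λ x → x ∈ C × r · x ≈ 0#
    ; resp     = λ x≋y (x∈C , r·x≈0) → resp C x≋y x∈C , trans (sym (·-congˡ r x≋y)) r·x≈0
    ; zero∈    = zero∈ C , ·-zeroʳ r
    ; +-closed = λ (x∈C , r·x≈0) (y∈C , r·y≈0) →
        +-closed C x∈C y∈C , trans (·-additive r _ _) (trans (+-cong r·x≈0 r·y≈0) (+-identityˡ 0#))
    ; ·-closed = λ a (x∈C , r·x≈0) →
        ·-closed C a x∈C , trans (·-homogeneous r a _) (trans (*-congˡ r·x≈0) (zeroʳ a))
    }

  shorten : ∀ {n} → LinearCode 𝔽 (ℕ.suc n) → LinearCode 𝔽 n
  shorten C = record
    { _∈C      = λ u → (0# ∷ u) ∈ C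
    ; resp     = λ u≋v → resp C λ { zero → refl ; (suc t) → u≋v t }
    ; zero∈    = resp C (λ { zero → refl ; (suc t) → refl }) (zero∈ C)
    ; +-closed = λ u∈ v∈ → resp C (λ { zero → +-identityˡ 0# ; (suc t) → refl }) (+-closed C u∈ v∈)
    ; ·-closed = λ a u∈ → resp C (λ { zero → zeroʳ a ; (suc t) → refl }) (·-closed C a u∈)
    }

  tail∈shorten : ∀ {n} (C : LinearCode 𝔽 (ℕ.suc n)) {x} → x ∈ C → x zero ≈ 0# → tail x ∈ shorten C
  tail∈shorten C x∈C x₀≈0 = resp C (λ { zero → x₀≈0 ; (suc t) → refl }) x∈C

  kernel : ∀ {R T} → (Fin R → Vec T) → LinearCode 𝔽 T
  kernel {ℕ.zero}  M = wholeSpace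
  kernel {ℕ.suc R} M = kernel (M ∘ suc) ∩⊥ M zero

  ∈kernel⇒orthogonal : ∀ {R T} (M : Fin R → Vec T) {x} → x ∈ kernel M → ∀ e → M e · x ≈ 0#
  ∈kernel⇒orthogonal M (_    , M₀·x≈0) zero    = M₀·x≈0
  ∈kernel⇒orthogonal M (x∈ker , _)     (suc e) = ∈kernel⇒orthogonal (M ∘ suc) x∈ker e

  orthogonal⇒∈kernel : ∀ {R T} (M : Fin R → Vec T) {x} → (∀ e → M e · x ≈ 0#) → x ∈ kernel M
  orthogonal⇒∈kernel {ℕ.zero}  M M·x≈0 = _
  orthogonal⇒∈kernel {ℕ.suc R} M M·x≈0 = orthogonal⇒∈kernel (M ∘ suc) (M·x≈0 ∘ suc) , M·x≈0 zero

  record IntegralSpan {n} (C : LinearCode 𝔽 n) : Set (c ⊔ ℓ) where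
    field
      size     : ℕ
      vectors  : Fin size → Vec n
      integral : ∀ i → IntegralVec (vectors i)
      members  : ∀ i → vectors i ∈ C
      spanning : ∀ x → x ∈ C → ∃[ a ] (x ≋ lincomb a vectors)

  IntegralBasis : ∀ {n} → LinearCode 𝔽 n → Set (c ⊔ ℓ)
  IntegralBasis C = ∃[ k ] ∃[ b ] (IsBasis 𝔽 C {k} b × ∀ i → IntegralVec (b i))

  integralSpan-wholeSpace : ∀ {n} → IntegralSpan (wholeSpace {n})
  integralSpan-wholeSpace = record
    { size     = _
    ; vectors  = unit
    ; integral = unit-integral
    ; members  = _
    ; spanning = λ x _ → x , λ t → sym (lincomb-unit x t)
    }

  integralSpan-puncture : ∀ {m n} {D : LinearCode 𝔽 m} {C : LinearCode 𝔽 n} (π : Fin n → Fin m) →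
    (∀ z → z ∈ D → z ∘ π ∈ C) → (∀ x → x ∈ C → ∃[ z ] (z ∈ D × x ≋ z ∘ π)) →
    IntegralSpan D → IntegralSpan C
  integralSpan-puncture π D⇒C C⇒D S = record
    { size     = size
    ; vectors  = λ i → vectors i ∘ π
    ; integral = λ i → integral i ∘ π
    ; members  = λ i → D⇒C _ (members i)
    ; spanning = λ x x∈C →
        let (z , z∈D , x≋z∘π) = C⇒D x x∈C
            (a , z≋ag) = spanning z z∈D
        in a , λ t → trans (x≋z∘π t) (z≋ag (π t))
    }
    where open IntegralSpan S

  integralSpan-shorten : ∀ {n} {C : LinearCode 𝔽 (ℕ.suc n)} →
    IntegralSpan (C ∩⊥ unit zero) → IntegralSpan (shorten C)
  integralSpan-shorten {C = C} = integralSpan-puncture suc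
    (λ z (z∈C , e₀·z≈0) → tail∈shorten C z∈C (trans (sym (unit₀·x≈x₀ z)) e₀·z≈0))
    (λ u u∈ → 0# ∷ u , (u∈ , unit₀·x≈x₀ (0# ∷ u)) , λ _ → refl)

  lincomb-eliminate : ∀ {k n} (g : Fin k → Vec n) (s a : Fin k → Carrier) j {β} →
    s j * β ≈ 1# → Σ𝔽 (λ i → a i * s i) ≈ 0# →
    lincomb (λ i → β * a i) (λ i → s j ⊙ g i ⊕ (- s i) ⊙ g j) ≋ lincomb a g
  lincomb-eliminate g s a j {β} sⱼβ≈1 Σas≈0 t = begin
    Σ𝔽 (λ i → β * a i * (s j * g i t + - s i * g j t))
      ≈⟨ Σ-cong (λ i → solve 6 (λ β a sⱼ g sᵢ gⱼ →
           β :* a :* (sⱼ :* g :+ :- sᵢ :* gⱼ) := sⱼ :* β :* (a :* g) :+ :- (β :* gⱼ) :* (a :* sᵢ))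
           refl β (a i) (s j) (g i t) (s i) (g j t)) ⟩
    Σ𝔽 (λ i → s j * β * (a i * g i t) + - (β * g j t) * (a i * s i))
      ≈⟨ Σ-linear (s j * β) (- (β * g j t)) (λ i → a i * g i t) (λ i → a i * s i) ⟩
    s j * β * lincomb a g t + - (β * g j t) * Σ𝔽 (λ i → a i * s i)
      ≈⟨ +-cong (*-congʳ sⱼβ≈1) (*-congˡ Σas≈0) ⟩
    1# * lincomb a g t + - (β * g j t) * 0#
      ≈⟨ trans (+-cong (*-identityˡ _) (zeroʳ _)) (+-identityʳ _) ⟩
    lincomb a g t ∎

  module _ {n} {C : LinearCode 𝔽 n} (S : IntegralSpan C) (r : Vec n) where
    open IntegralSpan S

    integralSpan-∩⊥-orthogonal : (∀ i → r · vectors i ≈ 0#) → IntegralSpan (C ∩⊥ r)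
    integralSpan-∩⊥-orthogonal r·g≈0 = record
      { size     = size
      ; vectors  = vectors
      ; integral = integral
      ; members  = λ i → members i , r·g≈0 i
      ; spanning = λ x (x∈C , _) → spanning x x∈C
      }

    integralSpan-∩⊥-pivot : IntegralVec r → ∀ j {β} → r · vectors j * β ≈ 1# → IntegralSpan (C ∩⊥ r)
    integralSpan-∩⊥-pivot r-integral j {β} sⱼβ≈1 = record
      { size     = size
      ; vectors  = h
      ; integral = λ i t → integral-+ (integral-* (s-integral j) (integral i t))
                                      (integral-* (integral-neg (s-integral i)) (integral j t))
      ; members  = λ i → +-closed C (·-closed C _ (members i)) (·-closed C _ (members j)) , r·h≈0 i
      ; spanning = λ x (x∈C , r·x≈0) →
          let (a , x≋ag) = spanning x x∈C
              Σas≈0 = trans (sym (·-lincomb r a vectors))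
                            (trans (·-congˡ r (λ t → sym (x≋ag t))) r·x≈0)
          in (λ i → β * a i) ,
             λ t → trans (x≋ag t) (sym (lincomb-eliminate vectors s a j sⱼβ≈1 Σas≈0 t))
      }
      where
      s : Fin size → Carrier
      s i = r · vectors i

      s-integral : ∀ i → Integral (s i)
      s-integral i = ·-integral r-integral (integral i)

      h : Fin size → Vec n
      h i = s j ⊙ vectors i ⊕ (- s i) ⊙ vectors j

      r·h≈0 : ∀ i → r · h i ≈ 0#
      r·h≈0 i = begin
        r · h i
          ≈⟨ ·-additive r _ _ ⟩
        r · (s j ⊙ vectors i) + r · ((- s i) ⊙ vectors j)
          ≈⟨ +-cong (·-homogeneous r _ _) (·-homogeneous r _ _) ⟩
        s j * s i + - s i * s j
          ≈⟨ solve 2 (λ sᵢ sⱼ → sⱼ :* sᵢ :+ :- sᵢ :* sⱼ := sⱼ :* sᵢ :+ :- (sⱼ :* sᵢ)) refl (s i) (s j) ⟩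
        s j * s i - s j * s i
          ≈⟨ -‿inverseʳ _ ⟩
        0#
          ∎

  integralSpan-∩⊥ : ∀ {n} {C : LinearCode 𝔽 n} {r} →
    IntegralVec r → IntegralSpan C → ¬ ¬ IntegralSpan (C ∩⊥ r)
  integralSpan-∩⊥ {r = r} r-integral S = do
    inj₂ (j , sⱼ≉0) ← ¬¬-allZero⊎nonzero (λ i → r · vectors i)
      where inj₁ s≈0 → return (integralSpan-∩⊥-orthogonal S r s≈0)
    let (β , sⱼβ≈1) = inverse _ sⱼ≉0
    return (integralSpan-∩⊥-pivot S r r-integral j sⱼβ≈1)
    where open IntegralSpan S

  integralSpan-kernel : ∀ {R T} (M : Fin R → Vec T) →
    (∀ e → IntegralVec (M e)) → ¬ ¬ IntegralSpan (kernel M)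
  integralSpan-kernel {ℕ.zero}  M M-integral = return integralSpan-wholeSpace
  integralSpan-kernel {ℕ.suc R} M M-integral = do
    S ← integralSpan-kernel (M ∘ suc) (M-integral ∘ suc)
    integralSpan-∩⊥ (M-integral zero) S

  module _ {n} {C : LinearCode 𝔽 (ℕ.suc n)} {k} {b : Fin k → Vec n}
           (b-basis : IsBasis 𝔽 (shorten C) b) where
    open IsBasis b-basis

    basis-lift : (∀ x → x ∈ C → x zero ≈ 0#) → IsBasis 𝔽 C (λ i → 0# ∷ b i)
    basis-lift vanishes = record
      { members     = members
      ; independent = λ a ab≈0 → independent a (ab≈0 ∘ suc)
      ; spanning    = λ x x∈C →
          let (a , tail-x≋ab) = spanning (tail x) (tail∈shorten C x∈C (vanishes x x∈C))
          in a , λ { zero    → trans (vanishes x x∈C) (sym (Σ-zero λ i → zeroʳ (a i)))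
                   ; (suc t) → tail-x≋ab t }
      }

    basis-extend : ∀ {w β} → w ∈ C → w zero * β ≈ 1# → IsBasis 𝔽 C (w ∷ λ i → 0# ∷ b i)
    basis-extend {w} {β} w∈C w₀β≈1 = record
      { members     = λ { zero → w∈C ; (suc i) → members i }
      ; independent = independent′
      ; spanning    = spanning′
      }
      where
      B : Fin (ℕ.suc k) → Vec (ℕ.suc n)
      B = w ∷ λ i → 0# ∷ b i

      head-coefficient : ∀ a → lincomb a B zero ≈ 0# → a zero ≈ 0#
      head-coefficient a aB₀≈0 = invertible⇒*-cancelʳ w₀β≈1 (begin
        a zero * w zero        ≈⟨ +-identityʳ _ ⟨
        a zero * w zero + 0#   ≈⟨ +-congˡ (Σ-zero λ i → zeroʳ (a (suc i))) ⟨
        lincomb a B zero       ≈⟨ aB₀≈0 ⟩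
        0#                     ∎)

      independent′ : ∀ a → lincomb a B ≋ Defs.zeroV 𝔽 → ∀ i → a i ≈ 0#
      independent′ a aB≈0 zero    = head-coefficient a (aB≈0 zero)
      independent′ a aB≈0 (suc i) = independent (tail a) tail-a-b≈0 i
        where
        tail-a-b≈0 : lincomb (tail a) b ≋ Defs.zeroV 𝔽
        tail-a-b≈0 t = begin
          lincomb (tail a) b t                     ≈⟨ +-identityˡ _ ⟨
          0# + lincomb (tail a) b t                ≈⟨ +-congʳ a₀w≈0 ⟨
          a zero * w (suc t) + lincomb (tail a) b t ≈⟨ aB≈0 (suc t) ⟩
          0#                                       ∎
          where a₀w≈0 = trans (*-congʳ (head-coefficient a (aB≈0 zero))) (zeroˡ _)

      spanning′ : ∀ x → x ∈ C → ∃[ a ] (x ≋ lincomb a B)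
      spanning′ x x∈C =
        let (a , tail-y≋ab) = spanning (tail y) (tail∈shorten C y∈C y₀≈0)
        in γ ∷ a , λ
          { zero → begin
              x zero                                   ≈⟨ γw₀≈x₀ ⟨
              γ * w zero                               ≈⟨ +-identityʳ _ ⟨
              γ * w zero + 0#                          ≈⟨ +-congˡ (Σ-zero λ i → zeroʳ (a i)) ⟨
              lincomb (γ ∷ a) B zero                   ∎
          ; (suc t) → begin
              x (suc t)                                ≈⟨ solve 3 (λ x γ w → x := γ :* w :+ (x :+ :- γ :* w))
                                                            refl (x (suc t)) γ (w (suc t)) ⟩
              γ * w (suc t) + y (suc t)                ≈⟨ +-congˡ (tail-y≋ab t) ⟩
              lincomb (γ ∷ a) B (suc t)                ∎
          }
        where
        γ : Carrier
        γ = x zero * β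

        γw₀≈x₀ : γ * w zero ≈ x zero
        γw₀≈x₀ = trans (*-assoc _ _ _) (trans (*-congˡ (trans (*-comm β _) w₀β≈1)) (*-identityʳ _))

        y : Vec (ℕ.suc n)
        y = x ⊕ (- γ) ⊙ w

        y∈C : y ∈ C
        y∈C = +-closed C x∈C (·-closed C _ w∈C)

        y₀≈0 : y zero ≈ 0#
        y₀≈0 = trans (+-congˡ (trans (sym (-‿distribˡ-* γ _)) (-‿cong γw₀≈x₀))) (-‿inverseʳ _)

  integralBasis : ∀ {n} (C : LinearCode 𝔽 n) → IntegralSpan C → ¬ ¬ IntegralBasis C
  integralBasis {ℕ.zero} C _ = return (0 , (λ ()) , emptyBasis , λ ())
    where
    emptyBasis : IsBasis 𝔽 C (λ ())
    emptyBasis = record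
      { members = λ () ; independent = λ _ _ () ; spanning = λ _ _ → (λ ()) , λ () }
  integralBasis {ℕ.suc n} C S = do
    S₀ ← integralSpan-∩⊥ (unit-integral zero) S
    (k , b , b-basis , b-integral) ← integralBasis (shorten C) (integralSpan-shorten S₀)
    let lifted-integral = λ i → ∷-integral integral-0 (b-integral i)
    inj₂ (j , vⱼ₀≉0) ← ¬¬-allZero⊎nonzero (λ i → vectors i zero)
      where inj₁ v₀≈0 → return (k , _ , basis-lift b-basis (vanishes v₀≈0) , lifted-integral)
    let (β , vⱼ₀β≈1) = inverse _ vⱼ₀≉0
    return (ℕ.suc k , _ , basis-extend b-basis (members j) vⱼ₀β≈1 ,
            λ { zero → integral j ; (suc i) → lifted-integral i })
    where
    open IntegralSpan S
    vanishes : (∀ i → vectors i zero ≈ 0#) → ∀ x → x ∈ C → x zero ≈ 0#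
    vanishes v₀≈0 x x∈C =
      let (a , x≋av) = spanning x x∈C
      in trans (x≋av zero) (Σ-zero λ i → trans (*-congˡ (v₀≈0 i)) (zeroʳ (a i)))

  incidence-integral : ∀ Δ e t → Integral (incidence 𝔽 Δ e t)
  incidence-integral Δ e t = 0/1-integral _
    where
    0/1-integral : ∀ b → Integral (if b then 1# else 0#)
    0/1-integral true  = integral-1
    0/1-integral false = integral-0

  triangularRepresentable⇒¬¬integralBasis : ∀ {n} {C : LinearCode 𝔽 n} →
    TriangularRepresentable 𝔽 C → ¬ ¬ IntegralBasis C
  triangularRepresentable⇒¬¬integralBasis {C = C} (Δ , π , _ , C≈ker/π , _) = do
    S ← integralSpan-kernel (incidence 𝔽 Δ) (incidence-integral Δ)
    integralBasis C (integralSpan-puncture π ker⇒C C⇒ker S)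
    where
    -- the second half of the representation is stated under a ∀ x it does not depend on
    ker⇒C : ∀ z → z ∈ kernel (incidence 𝔽 Δ) → z ∘ π ∈ C
    ker⇒C z z∈ker = proj₂ (C≈ker/π (Defs.zeroV 𝔽)) z (∈kernel⇒orthogonal _ z∈ker)

    C⇒ker : ∀ x → x ∈ C → ∃[ z ] (z ∈ kernel (incidence 𝔽 Δ) × x ≋ z ∘ π)
    C⇒ker x x∈C =
      let (z , z∈ker , x≋z∘π) = proj₁ (C≈ker/π x) x∈C
      in z , orthogonal⇒∈kernel _ z∈ker , x≋z∘π

mainTheorem3 : ∀ {c ℓ : Level} (𝔽 : Field c ℓ) (n : ℕ) (C : LinearCode 𝔽 n)
    → (∀ (k : ℕ) (B : Fin k → Vec𝔽 𝔽 n) → IsBasis 𝔽 C B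
        → ∃[ i ] ∃[ f ] ∃[ p ] (¬ CommonCyclic 𝔽 (B i f) (B i p)))
    → ¬ TriangularRepresentable 𝔽 C
mainTheorem3 𝔽 n C every-basis-has-noncyclic-pair representable =
  triangularRepresentable⇒¬¬integralBasis representable λ (k , b , b-basis , b-integral) →
    let (i , f , p , ¬cyclic) = every-basis-has-noncyclic-pair k b b-basis
    in ¬cyclic (integral⇒commonCyclic (b-integral i f) (b-integral i p))
  where
  open IntegerMultiples 𝔽
  open IntegralLinearAlgebra 𝔽
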